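{- Let $p$ be a prime, $m\in\mathbb{N}$, and let $\alpha\in\mathbb{R}_{>0}$ be a real number that is not an infinite loop mod $p^m$. Then $$m_p(\alpha)\le \frac{1}{\lfloor 2\sqrt{p^m}\rfloor-1}.$$
   Context: $\|x\|$ is the distance from $x$ to the nearest integer, $|\cdot|_p$ the $p$-adic absolute value, and $m_p(\alpha):=\inf_{q\in\mathbb{N}} q\,|q|_p\,\|q\alpha\|$. For $\alpha>0$ with continued fraction expansion $[a_0;a_1,a_2,\ldots]$, the convergent denominators are $q_{ -1}=0$, $q_0=1$, $q_k=a_kq_{k-1}+q_{k-2}$, and the semi-convergent denominators are $q_{\{k,m\}}=mq_k+q_{k-1}$ for $k\ge0$ and integers $0\le m\le a_{k+1}$ (if $\alpha$ is rational with finite expansion $[a_0;\ldots,a_N]$, one regards $a_{N+1}=\infty$, so all integers $m\ge0$ are allowed at $k=N$). For $n\in\mathbb{N}$, $\alpha>0$ is an infinite loop mod $n$ if none of its semi-convergent denominators is divisible by $n$, apart from $q_{ -1}=0$. -}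

module Defs where

open import Data.Nat as ℕ using (ℕ; zero; suc; _≤_; _<_; _⊓_; _^_; _∸_)
open import Data.Nat.Divisibility using (_∣_)
open import Data.Integer as ℤ using (ℤ; +_)
open import Data.Rational as ℚ using (ℚ)
open import Data.Product using (_×_; _,_; proj₁; proj₂; ∃; ∃-syntax)
open import Data.Sum using (_⊎_)
open import Relation.Binary.PropositionalEquality using (_≡_; _≢_)
open import Relation.Nullary using (¬_)

-- A positive real number, given by its (regular) continued fraction expansion
-- [a 0; a 1, a 2, ...].  finCF N a is the rational [a 0; a 1, ..., a N]
-- (entries a k for k > N are irrelevant), infCF a is the irrational
-- [a 0; a 1, a 2, ...].
data CF : Set where
  finCF : (N : ℕ) (a : ℕ → ℕ) → CF
  infCF : (a : ℕ → ℕ) → CF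

ValidPos : CF → Set
ValidPos (finCF N a) = (∀ k → 1 ≤ k → k ≤ N → 1 ≤ a k) × (1 ≤ a 0 ⊎ 1 ≤ N)
ValidPos (infCF a)   = ∀ k → 1 ≤ a (suc k)

-- (q_{k-1}, q_k) with q_{-1} = 0, q_0 = 1, q_k = a_k q_{k-1} + q_{k-2}
qPair : (ℕ → ℕ) → ℕ → ℕ × ℕ
qPair a zero = 0 , 1
qPair a (suc k) = proj₂ (qPair a k) , (a (suc k) ℕ.* proj₂ (qPair a k) ℕ.+ proj₁ (qPair a k))

-- (p_{k-1}, p_k) with p_{-1} = 1, p_0 = a_0, same recurrence
pPair : (ℕ → ℕ) → ℕ → ℕ × ℕ
pPair a zero = 1 , a 0
pPair a (suc k) = proj₂ (pPair a k) , (a (suc k) ℕ.* proj₂ (pPair a k) ℕ.+ proj₁ (pPair a k))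

qk : (ℕ → ℕ) → ℕ → ℕ
qk a k = proj₂ (qPair a k)

qk-1 : (ℕ → ℕ) → ℕ → ℕ
qk-1 a k = proj₁ (qPair a k)

pk : (ℕ → ℕ) → ℕ → ℕ
pk a k = proj₂ (pPair a k)

-- n / d as a rational (d = 0 never occurs for valid expansions)
frac : ℤ → ℕ → ℚ
frac n zero = ℚ.0ℚ
frac n (suc d) = n ℚ./ suc d

-- k-th rational approximation of α (the convergent p_k/q_k, frozen at k = N
-- for a finite expansion); α is the limit of this sequence.
approx : CF → ℕ → ℚ
approx (finCF N a) k = frac (+ pk a (k ⊓ N)) (qk a (k ⊓ N))
approx (infCF a) k   = frac (+ pk a k) (qk a k)

-- d is a semi-convergent denominator q_{k,m} = m q_k + q_{k-1}, k ≥ 0,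
-- 0 ≤ m ≤ a_{k+1} (a_{N+1} = ∞ in the finite case).
SemiConvDen : CF → ℕ → Set
SemiConvDen (finCF N a) d =
  ∃[ k ] ∃[ m ] (k ≤ N × (k < N → m ≤ a (suc k)) × d ≡ m ℕ.* qk a k ℕ.+ qk-1 a k)
SemiConvDen (infCF a) d =
  ∃[ k ] ∃[ m ] (m ≤ a (suc k) × d ≡ m ℕ.* qk a k ℕ.+ qk-1 a k)

-- α is an infinite loop mod n: no semi-convergent denominator other than
-- q_{-1} = 0 is divisible by n.
InfiniteLoop : ℕ → CF → Set
InfiniteLoop n α = ∀ d → SemiConvDen α d → n ∣ d → d ≡ 0

-- p-adic valuation: v = v_p(q), so |q|_p = p^(-v)
PadicVal : ℕ → ℕ → ℕ → Set
PadicVal p q v = (p ^ v) ∣ q × ¬ ((p ^ suc v) ∣ q)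

-- "lim_k f k < B" for a convergent sequence of rationals f
LimLt : (ℕ → ℚ) → ℚ → Set
LimLt f B = ∃[ δ ] (ℚ.0ℚ ℚ.< δ × ∃[ K ] (∀ k → K ≤ k → f k ℚ.≤ B ℚ.- δ))

-- q |q|_p ‖q α‖ < B  (with |q|_p = p^(-v), v = v_p(q)):
-- there is an integer z with (q / p^v) · |q α - z| < B.
WeightedDistLt : ℕ → CF → ℕ → ℚ → Set
WeightedDistLt p α q B =
  ∃[ v ] (PadicVal p q v × ∃[ z ]
    LimLt (λ k → frac (+ q) (p ^ v) ℚ.* ℚ.∣ frac (+ q) 1 ℚ.* approx α k ℚ.- frac z 1 ∣) B)

-- m_p(α) ≤ B, where m_p(α) = inf_{q ≥ 1} q |q|_p ‖q α‖
mpLe : ℕ → CF → ℚ → Set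
mpLe p α B = ∀ ε → ℚ.0ℚ ℚ.< ε → ∃[ q ] (1 ≤ q × WeightedDistLt p α q (B ℚ.+ ε))

{-# OPTIONS --safe #-}
-- Write T = s - 1, so s² ≤ 4 p^m.  A rational α = p_N / q_N gives q_N ‖q_N α‖ = 0.  Otherwise let
-- d = j q_k + q_(k-1) be the semi-convergent divisible by p^m (so d |d|_p ≤ d / p^m) and z = j p_k + p_(k-1).
-- Every later convergent satisfies q_n = q_(k+1) A + q_k C with C ≤ A, the same for p_n, and the determinant
-- identity gives |d p_n - z q_n| = W := (a_(k+1) - j) A + C.  If q_(k+1) ≥ T q_k, the same identity for the
-- convergent q_k (the semi-convergent with index k + 1 and j = 0) gives q_k ‖q_k α‖ ≤ q_k / q_(k+1) ≤ 1 / T.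
-- Otherwise q_n = d A + q_k W ≤ s q_k A, and AM-GM, 4 (d A) (q_k W) ≤ q_n², yields d W T ≤ p^m q_n,
-- i.e. d |d|_p ‖d α‖ ≤ 1 / T.
module Submission where

open import Defs
open import Data.Nat as ℕ
  using (ℕ; zero; suc; _≤_; _<_; _*_; _+_; _^_; _∸_; ∣_-_∣; s≤s; z≤n; NonZero; NonTrivial; nonTrivial⇒n>1)
open import Data.Nat.Properties
open import Data.Nat.Divisibility
open import Data.Nat.Induction using (<-wellFounded)
open import Data.Nat.Primality using (Prime; prime⇒nonZero; prime⇒nonTrivial)
import Data.Nat.Tactic.RingSolver as ℕ-Ring
open import Data.Integer as ℤ using (+_; _⊖_)
import Data.Integer.Properties as ℤP
import Data.Integer.Tactic.RingSolver as ℤ-Ring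
import Data.Rational as ℚ
import Data.Rational.Properties as ℚP
open import Data.Rational.Unnormalised as ℚᵘ using (mkℚᵘ; *≡*; *≤*)
import Data.Rational.Unnormalised.Properties as ℚᵘP
open import Data.Product using (_×_; _,_; proj₁; proj₂; ∃-syntax)
open import Data.Sum using (inj₁; inj₂)
open import Data.Empty using (⊥-elim)
open import Induction.WellFounded using (Acc; acc)
open import Relation.Binary.PropositionalEquality
open import Relation.Nullary using (yes; no)

∣-∣-scale : ∀ u v c x y → u + c * y ≡ v + c * x → ∣ u - v ∣ ≡ c * ∣ x - y ∣
∣-∣-scale u v c x y eq = begin
  ∣ u - v ∣                  ≡⟨ ∣m+n-m+o∣≡∣n-o∣ (c * y) u v ⟨
  ∣ c * y + u - c * y + v ∣  ≡⟨ cong₂ ∣_-_∣ (trans (+-comm (c * y) u) eq) (+-comm (c * y) v) ⟩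
  ∣ v + c * x - v + c * y ∣  ≡⟨ ∣m+n-m+o∣≡∣n-o∣ v (c * x) (c * y) ⟩
  ∣ c * x - c * y ∣          ≡⟨ *-distribˡ-∣-∣ c x y ⟨
  c * ∣ x - y ∣              ∎
  where open ≡-Reasoning

4xy≤[x+y]² : ∀ x y → 4 * x * y ≤ (x + y) * (x + y)
4xy≤[x+y]² x y with ≤-total x y
... | inj₁ x≤y with m≤n⇒∃[o]m+o≡n x≤y
...   | o , refl = subst (4 * x * (x + o) ≤_) (square x o) (m≤m+n _ _)
  where
  square : ∀ x o → 4 * x * (x + o) + o * o ≡ (x + (x + o)) * (x + (x + o))
  square = ℕ-Ring.solve-∀
4xy≤[x+y]² x y | inj₂ y≤x with m≤n⇒∃[o]m+o≡n y≤x
...   | o , refl = subst (4 * (y + o) * y ≤_) (square y o) (m≤m+n _ _)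
  where
  square : ∀ y o → 4 * (y + o) * y + o * o ≡ ((y + o) + y) * ((y + o) + y)
  square = ℕ-Ring.solve-∀

product-≤-by-amgm : ∀ x y a b T N → 1 ≤ a → 1 ≤ b → suc T * suc T ≤ 4 * N →
  x * a + b * y ≤ b * suc T * a → x * y * T ≤ N * (x * a + b * y)
product-≤-by-amgm x y a@(suc _) b@(suc _) T N _ _ [T+1]²≤4N S≤ = *-cancelˡ-≤ (4 * a * b) (begin
  4 * a * b * (x * y * T)        ≡⟨ e₁ x y a b T ⟩
  T * (4 * (x * a) * (b * y))    ≤⟨ *-monoʳ-≤ T (4xy≤[x+y]² (x * a) (b * y)) ⟩
  T * (S * S)                    ≡⟨ *-assoc T S S ⟨
  T * S * S                      ≤⟨ *-monoˡ-≤ S TS≤ ⟩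
  4 * N * (b * a) * S            ≡⟨ e₂ N a b S ⟩
  4 * a * b * (N * S)            ∎)
  where
  open ≤-Reasoning
  S = x * a + b * y
  e₁ : ∀ x y a b T → 4 * a * b * (x * y * T) ≡ T * (4 * (x * a) * (b * y))
  e₁ = ℕ-Ring.solve-∀
  e₂ : ∀ N a b S → 4 * N * (b * a) * S ≡ 4 * a * b * (N * S)
  e₂ = ℕ-Ring.solve-∀
  e₃ : ∀ T b a → T * (b * suc T * a) ≡ T * suc T * (b * a)
  e₃ = ℕ-Ring.solve-∀
  TS≤ : T * S ≤ 4 * N * (b * a)
  TS≤ = begin
    T * S                      ≤⟨ *-monoʳ-≤ T S≤ ⟩
    T * (b * suc T * a)        ≡⟨ e₃ T b a ⟩
    T * suc T * (b * a)        ≤⟨ *-monoˡ-≤ (b * a) (*-monoˡ-≤ (suc T) (n≤1+n T)) ⟩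
    suc T * suc T * (b * a)    ≤⟨ *-monoˡ-≤ (b * a) [T+1]²≤4N ⟩
    4 * N * (b * a)            ∎

^-monoʳ-∣ : ∀ p {m n} → m ≤ n → p ^ m ∣ p ^ n
^-monoʳ-∣ p {m} m≤n with m≤n⇒∃[o]m+o≡n m≤n
... | o , refl = subst (p ^ m ∣_) (sym (^-distribˡ-+-* p m o)) (m∣m*n (p ^ o))

padicVal-exists : ∀ p .{{_ : NonTrivial p}} .{{_ : NonZero p}} q → 1 ≤ q → ∃[ v ] PadicVal p q v
padicVal-exists p q 1≤q = go q 1≤q (<-wellFounded q)
  where
  go : ∀ q → 1 ≤ q → Acc _<_ q → ∃[ v ] PadicVal p q v
  go q 1≤q (acc rec) with p ∣? q
  ... | no p∤q = 0 , 1∣ q , λ p¹∣q → p∤q (subst (_∣ q) (*-identityʳ p) p¹∣q)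
  go .(q′ * p) 1≤q (acc rec) | yes (divides q′@(suc _) refl)
    with go q′ (s≤s z≤n) (rec (m<m*n q′ p (nonTrivial⇒n>1 p)))
  ... | v , p^v∣q′ , p^1+v∤q′ =
    suc v , subst (_∣ q′ * p) (*-comm (p ^ v) p) (*-monoˡ-∣ p p^v∣q′)
          , λ p^2+v∣q → p^1+v∤q′ (*-cancelʳ-∣ p (subst (_∣ q′ * p) (*-comm p (p ^ suc v)) p^2+v∣q))

padicVal-≥ : ∀ {p q v m} → PadicVal p q v → p ^ m ∣ q → m ≤ v
padicVal-≥ {p} {v = v} {m} (_ , p^1+v∤q) p^m∣q with m ≤? v
... | yes m≤v = m≤v
... | no m≰v = ⊥-elim (p^1+v∤q (∣-trans (^-monoʳ-∣ p (≰⇒> m≰v)) p^m∣q))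

step : ℕ → ℕ × ℕ → ℕ × ℕ
step b u = proj₂ u , b * proj₂ u + proj₁ u

IsSolution : (ℕ → ℕ) → (ℕ → ℕ × ℕ) → Set
IsSolution a X = ∀ n → X (suc n) ≡ step (a (suc n)) (X n)

run : (ℕ → ℕ) → ℕ → ℕ → ℕ × ℕ → ℕ × ℕ
run a k zero    u = u
run a k (suc i) u = run a (suc k) i (step (a (suc k)) u)

solution-run : ∀ {a X} → IsSolution a X → ∀ k i → X (k + i) ≡ run a k i (X k)
solution-run {X = X} sol k zero    = cong X (+-identityʳ k)
solution-run {a} {X} sol k (suc i) = begin
  X (k + suc i)                ≡⟨ cong X (+-suc k i) ⟩
  X (suc k + i)                ≡⟨ solution-run sol (suc k) i ⟩
  run a (suc k) i (X (suc k))  ≡⟨ cong (run a (suc k) i) (sol k) ⟩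
  run a k (suc i) (X k)        ∎
  where open ≡-Reasoning

combine : ℕ → ℕ × ℕ → ℕ → ℕ × ℕ → ℕ × ℕ
combine x u y v = x * proj₁ u + y * proj₁ v , x * proj₂ u + y * proj₂ v

step-combine : ∀ b x u y v → step b (combine x u y v) ≡ combine x (step b u) y (step b v)
step-combine b x (u₁ , u₂) y (v₁ , v₂) = cong (x * u₂ + y * v₂ ,_) (distrib b x y u₁ u₂ v₁ v₂)
  where
  distrib : ∀ b x y u₁ u₂ v₁ v₂ →
    b * (x * u₂ + y * v₂) + (x * u₁ + y * v₁) ≡ x * (b * u₂ + u₁) + y * (b * v₂ + v₁)
  distrib = ℕ-Ring.solve-∀

run-combine : ∀ a k i x u y v → run a k i (combine x u y v) ≡ combine x (run a k i u) y (run a k i v)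
run-combine a k zero    x u y v = refl
run-combine a k (suc i) x u y v =
  trans (cong (run a (suc k) i) (step-combine (a (suc k)) x u y v)) (run-combine a (suc k) i x _ y _)

combine-basis : ∀ u → u ≡ combine (proj₂ u) (0 , 1) (proj₁ u) (1 , 0)
combine-basis (u₁ , u₂) = cong₂ _,_ (basis₁ u₁ u₂) (basis₂ u₁ u₂)
  where
  basis₁ : ∀ u₁ u₂ → u₁ ≡ u₂ * 0 + u₁ * 1
  basis₁ = ℕ-Ring.solve-∀
  basis₂ : ∀ u₁ u₂ → u₂ ≡ u₂ * 1 + u₁ * 0
  basis₂ = ℕ-Ring.solve-∀

leadCoeff lagCoeff : (ℕ → ℕ) → ℕ → ℕ → ℕ
leadCoeff a k i = proj₂ (run a (suc k) i (0 , 1))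
lagCoeff  a k i = proj₂ (run a (suc k) i (1 , 0))

solution-split : ∀ {a X} → IsSolution a X → ∀ k i →
  proj₂ (X (suc k + i)) ≡ proj₂ (X (suc k)) * leadCoeff a k i + proj₁ (X (suc k)) * lagCoeff a k i
solution-split {a} {X} sol k i = cong proj₂ (begin
  X (suc k + i)                        ≡⟨ solution-run sol (suc k) i ⟩
  run a (suc k) i (X (suc k))          ≡⟨ cong (run a (suc k) i) (combine-basis (X (suc k))) ⟩
  run a (suc k) i (combine x₁ (0 , 1) x₀ (1 , 0))
    ≡⟨ run-combine a (suc k) i x₁ (0 , 1) x₀ (1 , 0) ⟩
  combine x₁ (run a (suc k) i (0 , 1)) x₀ (run a (suc k) i (1 , 0))  ∎)
  where
  open ≡-Reasoning
  x₁ = proj₂ (X (suc k))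
  x₀ = proj₁ (X (suc k))

qk-split : ∀ a k i → qk a (suc k + i) ≡ qk a (suc k) * leadCoeff a k i + qk a k * lagCoeff a k i
qk-split a k i = solution-split {a} {qPair a} (λ _ → refl) k i

pk-split : ∀ a k i → pk a (suc k + i) ≡ pk a (suc k) * leadCoeff a k i + pk a k * lagCoeff a k i
pk-split a k i = solution-split {a} {pPair a} (λ _ → refl) k i

_≤²_ : ℕ × ℕ → ℕ × ℕ → Set
u ≤² v = proj₁ u ≤ proj₁ v × proj₂ u ≤ proj₂ v

step-mono-≤² : ∀ b {u v} → u ≤² v → step b u ≤² step b v
step-mono-≤² b (u₁≤v₁ , u₂≤v₂) = u₂≤v₂ , +-mono-≤ (*-monoʳ-≤ b u₂≤v₂) u₁≤v₁

run-mono-≤² : ∀ a k i {u v} → u ≤² v → run a k i u ≤² run a k i v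
run-mono-≤² a k zero    u≤v = u≤v
run-mono-≤² a k (suc i) u≤v = run-mono-≤² a (suc k) i (step-mono-≤² (a (suc k)) u≤v)

step-proj₂-≥ : ∀ {b} u → 1 ≤ b → proj₂ u ≤ proj₂ (step b u)
step-proj₂-≥ {suc b} (u₁ , u₂) _ = ≤-trans (m≤n*m u₂ (suc b)) (m≤m+n _ u₁)

run-proj₂-≥ : ∀ {a} → (∀ n → 1 ≤ a (suc n)) → ∀ k i u → proj₂ u ≤ proj₂ (run a k i u)
run-proj₂-≥ pos k zero    u = ≤-refl
run-proj₂-≥ pos k (suc i) u = ≤-trans (step-proj₂-≥ u (pos k)) (run-proj₂-≥ pos (suc k) i _)

1≤leadCoeff : ∀ {a} → (∀ n → 1 ≤ a (suc n)) → ∀ k i → 1 ≤ leadCoeff a k i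
1≤leadCoeff pos k i = run-proj₂-≥ pos (suc k) i (0 , 1)

lagCoeff≤leadCoeff : ∀ a k → 1 ≤ a (suc (suc k)) → ∀ i → lagCoeff a k i ≤ leadCoeff a k i
lagCoeff≤leadCoeff a k 1≤b zero    = z≤n
lagCoeff≤leadCoeff a k 1≤b (suc i) = proj₂ (run-mono-≤² a (suc (suc k)) i (z≤n , 1≤b*1+0 (a (suc (suc k))) 1≤b))
  where
  1≤b*1+0 : ∀ b → 1 ≤ b → b * 0 + 1 ≤ b * 1 + 0
  1≤b*1+0 b 1≤b rewrite *-zeroʳ b | *-identityʳ b | +-identityʳ b = 1≤b

1≤qk : ∀ a k → (∀ n → n < k → 1 ≤ a (suc n)) → 1 ≤ qk a k
1≤qk a zero    pos = ≤-refl
1≤qk a (suc k) pos = ≤-trans (1≤qk a k (λ n n<k → pos n (m<n⇒m<1+n n<k))) (step-proj₂-≥ (qPair a k) (pos k ≤-refl))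

pk-1 : (ℕ → ℕ) → ℕ → ℕ
pk-1 a k = proj₁ (pPair a k)

convergent-det : ∀ a k → ∣ pk a k * qk-1 a k - qk a k * pk-1 a k ∣ ≡ 1
convergent-det a zero    = cong (λ x → ∣ x - 1 ∣) (*-zeroʳ (a 0))
convergent-det a (suc k) = begin
  ∣ (b * P + P′) * Q - (b * Q + R) * P ∣
    ≡⟨ ∣-∣-scale ((b * P + P′) * Q) ((b * Q + R) * P) 1 (Q * P′) (P * R) (swap b P P′ Q R) ⟩
  1 * ∣ Q * P′ - P * R ∣                  ≡⟨ *-identityˡ _ ⟩
  ∣ Q * P′ - P * R ∣                      ≡⟨ ∣-∣-comm (Q * P′) (P * R) ⟩
  ∣ P * R - Q * P′ ∣                      ≡⟨ convergent-det a k ⟩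
  1                                       ∎
  where
  open ≡-Reasoning
  b = a (suc k); P = pk a k; P′ = pk-1 a k; Q = qk a k; R = qk-1 a k
  swap : ∀ b P P′ Q R → (b * P + P′) * Q + 1 * (P * R) ≡ (b * Q + R) * P + 1 * (Q * P′)
  swap = ℕ-Ring.solve-∀

semiConvDen semiConvNum : (ℕ → ℕ) → ℕ → ℕ → ℕ
semiConvDen a k j = j * qk a k + qk-1 a k
semiConvNum a k j = j * pk a k + pk-1 a k

semiconvergent-error : ∀ a k j r i → a (suc k) ≡ j + r →
  ∣ semiConvDen a k j * pk a (suc k + i) - semiConvNum a k j * qk a (suc k + i) ∣ ≡ r * leadCoeff a k i + lagCoeff a k i
semiconvergent-error a k j r i b≡j+r = begin
  ∣ d * pk a (suc k + i) - z * qk a (suc k + i) ∣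
    ≡⟨ cong₂ (λ x y → ∣ d * x - z * y ∣) (pk-split a k i)
                                           (qk-split a k i) ⟩
  ∣ d * ((b * P + P′) * A + P * C) - z * ((b * Q + R) * A + Q * C) ∣
    ≡⟨ ∣-∣-scale (d * ((b * P + P′) * A + P * C)) (z * ((b * Q + R) * A + Q * C)) W (P * R) (Q * P′)
                 (cross b j r P P′ Q R A C b≡j+r) ⟩
  W * ∣ P * R - Q * P′ ∣  ≡⟨ cong (W *_) (convergent-det a k) ⟩
  W * 1                   ≡⟨ *-identityʳ W ⟩
  W                       ∎
  where
  open ≡-Reasoning
  b = a (suc k); P = pk a k; P′ = pk-1 a k; Q = qk a k; R = qk-1 a k
  d = semiConvDen a k j; z = semiConvNum a k j
  A = leadCoeff a k i; C = lagCoeff a k i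
  W = r * A + C
  cross : ∀ b j r P P′ Q R A C → b ≡ j + r →
    (j * Q + R) * ((b * P + P′) * A + P * C) + (r * A + C) * (Q * P′)
      ≡ (j * P + P′) * ((b * Q + R) * A + Q * C) + (r * A + C) * (P * R)
  cross .(j + r) j r P P′ Q R A C refl = identity j r P P′ Q R A C
    where
    identity : ∀ j r P P′ Q R A C →
      (j * Q + R) * (((j + r) * P + P′) * A + P * C) + (r * A + C) * (Q * P′)
        ≡ (j * P + P′) * (((j + r) * Q + R) * A + Q * C) + (r * A + C) * (P * R)
    identity = ℕ-Ring.solve-∀

toℚᵘ-frac : ∀ i d → ℚ.toℚᵘ (frac i (suc d)) ℚᵘ.≃ mkℚᵘ i d
toℚᵘ-frac i d = ℚP.toℚᵘ-fromℚᵘ (mkℚᵘ i d)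

∣+m-+n∣≡∣m-n∣ : ∀ m n → ℤ.∣ + m ℤ.- + n ∣ ≡ ∣ m - n ∣
∣+m-+n∣≡∣m-n∣ m n with ≤-total m n
... | inj₁ m≤n = begin
  ℤ.∣ + m ℤ.- + n ∣  ≡⟨ cong ℤ.∣_∣ (ℤP.m-n≡m⊖n m n) ⟩
  ℤ.∣ m ⊖ n ∣        ≡⟨ ℤP.∣⊖∣-≤ m≤n ⟩
  n ∸ m              ≡⟨ m≤n⇒∣n-m∣≡n∸m m≤n ⟨
  ∣ n - m ∣          ≡⟨ ∣-∣-comm n m ⟩
  ∣ m - n ∣          ∎
  where open ≡-Reasoning
... | inj₂ n≤m = begin
  ℤ.∣ + m ℤ.- + n ∣  ≡⟨ cong ℤ.∣_∣ (ℤP.m-n≡m⊖n m n) ⟩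
  ℤ.∣ m ⊖ n ∣        ≡⟨ cong ℤ.∣_∣ (ℤP.⊖-≥ n≤m) ⟩
  m ∸ n              ≡⟨ m≤n⇒∣n-m∣≡n∸m n≤m ⟨
  ∣ m - n ∣          ∎
  where open ≡-Reasoning

-- The rewrites turn the denominators of the ℚᵘ product and difference into 1 + d.
linear-form-≃ : ∀ i j k d →
  mkℚᵘ i 0 ℚᵘ.* mkℚᵘ j d ℚᵘ.- mkℚᵘ k 0 ℚᵘ.≃ mkℚᵘ (i ℤ.* j ℤ.- k ℤ.* + suc d) d
linear-form-≃ i j k d rewrite +-identityʳ d | *-identityʳ d = *≡* (identity i j k (+ suc d))
  where
  identity : ∀ i j k D → ((i ℤ.* j) ℤ.* ℤ.1ℤ ℤ.+ (ℤ.- k) ℤ.* D) ℤ.* D ≡ (i ℤ.* j ℤ.- k ℤ.* D) ℤ.* D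
  identity = ℤ-Ring.solve-∀

distance-to-integer : ∀ q P z d →
  ℚ.toℚᵘ ℚ.∣ frac (+ q) 1 ℚ.* frac (+ P) (suc d) ℚ.- frac (+ z) 1 ∣ ℚᵘ.≃ mkℚᵘ (+ ∣ q * P - z * suc d ∣) d
distance-to-integer q P z d = begin-equality
  ℚ.toℚᵘ ℚ.∣ X ℚ.- Z ∣                                   ≃⟨ ℚP.toℚᵘ-homo-∣-∣ (X ℚ.- Z) ⟩
  ℚᵘ.∣ ℚ.toℚᵘ (X ℚ.- Z) ∣                                ≃⟨ ℚᵘP.∣-∣-cong (ℚᵘP.≃-trans difference
                                                                (linear-form-≃ (+ q) (+ P) (+ z) d)) ⟩
  ℚᵘ.∣ mkℚᵘ (+ q ℤ.* + P ℤ.- + z ℤ.* + suc d) d ∣        ≡⟨ cong (λ n → mkℚᵘ (+ n) d) numerator ⟩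
  mkℚᵘ (+ ∣ q * P - z * suc d ∣) d                        ∎
  where
  open ℚᵘP.≤-Reasoning
  X = frac (+ q) 1 ℚ.* frac (+ P) (suc d)
  Z = frac (+ z) 1
  difference : ℚ.toℚᵘ (X ℚ.- Z) ℚᵘ.≃ mkℚᵘ (+ q) 0 ℚᵘ.* mkℚᵘ (+ P) d ℚᵘ.- mkℚᵘ (+ z) 0
  difference = ℚᵘP.≃-trans (ℚP.toℚᵘ-homo-+ X (ℚ.- Z)) (ℚᵘP.+-cong
    (ℚᵘP.≃-trans (ℚP.toℚᵘ-homo-* (frac (+ q) 1) (frac (+ P) (suc d)))
                 (ℚᵘP.*-cong (toℚᵘ-frac (+ q) 0) (toℚᵘ-frac (+ P) d)))
    (ℚᵘP.≃-trans (ℚP.toℚᵘ-homo‿- Z) (ℚᵘP.-‿cong (toℚᵘ-frac (+ z) 0))))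
  numerator : ℤ.∣ + q ℤ.* + P ℤ.- + z ℤ.* + suc d ∣ ≡ ∣ q * P - z * suc d ∣
  numerator = trans (sym (cong₂ (λ x y → ℤ.∣ x ℤ.- y ∣) (ℤP.pos-* q P) (ℤP.pos-* z (suc d))))
                    (∣+m-+n∣≡∣m-n∣ (q * P) (z * suc d))

weighted-distance-≤ : ∀ q e P Q z T → 1 ≤ e → 1 ≤ Q → 1 ≤ T → q * ∣ q * P - z * Q ∣ * T ≤ e * Q →
  frac (+ q) e ℚ.* ℚ.∣ frac (+ q) 1 ℚ.* frac (+ P) Q ℚ.- frac (+ z) 1 ∣ ℚ.≤ frac (+ 1) T
weighted-distance-≤ q (suc e) P (suc d) z (suc t) _ _ _ le = ℚP.toℚᵘ-cancel-≤ (begin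
  ℚ.toℚᵘ (frac (+ q) (suc e) ℚ.* ∣X∣)          ≃⟨ ℚP.toℚᵘ-homo-* (frac (+ q) (suc e)) ∣X∣ ⟩
  ℚ.toℚᵘ (frac (+ q) (suc e)) ℚᵘ.* ℚ.toℚᵘ ∣X∣
    ≃⟨ ℚᵘP.*-cong (toℚᵘ-frac (+ q) e) (distance-to-integer q P z d) ⟩
  mkℚᵘ (+ q) e ℚᵘ.* mkℚᵘ (+ W) d
    ≤⟨ *≤* (subst₂ ℤ._≤_ lhs (sym (ℤP.*-identityˡ _)) (ℤ.+≤+ le)) ⟩
  mkℚᵘ (+ 1) t                                  ≃⟨ toℚᵘ-frac (+ 1) t ⟨
  ℚ.toℚᵘ (frac (+ 1) (suc t))                   ∎)
  where
  open ℚᵘP.≤-Reasoning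
  ∣X∣ = ℚ.∣ frac (+ q) 1 ℚ.* frac (+ P) (suc d) ℚ.- frac (+ z) 1 ∣
  W = ∣ q * P - z * suc d ∣
  lhs : + (q * W * suc t) ≡ + q ℤ.* + W ℤ.* + suc t
  lhs = trans (ℤP.pos-* (q * W) (suc t)) (cong (ℤ._* + suc t) (ℤP.pos-* q W))

mpLe-intro : ∀ {p α B} q v z K → 1 ≤ q → PadicVal p q v →
  (∀ k → K ≤ k → frac (+ q) (p ^ v) ℚ.* ℚ.∣ frac (+ q) 1 ℚ.* approx α k ℚ.- frac z 1 ∣ ℚ.≤ B) →
  mpLe p α B
mpLe-intro {B = B} q v z K 1≤q val bound ε ε>0 =
  q , 1≤q , v , val , z , ε , ε>0 , K , λ k K≤k → subst (_ ℚ.≤_) (sym B+ε-ε≡B) (bound k K≤k)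
  where
  B+ε-ε≡B : B ℚ.+ ε ℚ.- ε ≡ B
  B+ε-ε≡B = trans (ℚP.+-assoc B ε (ℚ.- ε)) (trans (cong (B ℚ.+_) (ℚP.+-inverseʳ ε)) (ℚP.+-identityʳ B))

convergent-growth-≤ : ∀ Q Q′ b A C T e → 1 ≤ e → Q * T ≤ Q′ →
  Q * (b * A + C) * T ≤ e * ((b * Q′ + Q) * A + Q′ * C)
convergent-growth-≤ Q Q′ b A C T (suc e) _ QT≤Q′ = begin
  Q * W * T                     ≡⟨ commute Q W T ⟩
  Q * T * W                     ≤⟨ *-monoˡ-≤ W QT≤Q′ ⟩
  Q′ * W                        ≤⟨ m≤m+n (Q′ * W) (Q * A) ⟩
  Q′ * W + Q * A                ≡⟨ expand Q Q′ b A C ⟩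
  (b * Q′ + Q) * A + Q′ * C     ≤⟨ m≤n*m _ (suc e) ⟩
  suc e * ((b * Q′ + Q) * A + Q′ * C)  ∎
  where
  open ≤-Reasoning
  W = b * A + C
  commute : ∀ Q W T → Q * W * T ≡ Q * T * W
  commute = ℕ-Ring.solve-∀
  expand : ∀ Q Q′ b A C → Q′ * (b * A + C) + Q * A ≡ (b * Q′ + Q) * A + Q′ * C
  expand = ℕ-Ring.solve-∀

semiconvergent-growth-≤ : ∀ b j r Q R A C T N → b ≡ j + r → 1 ≤ A → 1 ≤ Q → C ≤ A →
  b * Q + R ≤ Q * T → suc T * suc T ≤ 4 * N →
  (j * Q + R) * (r * A + C) * T ≤ N * ((b * Q + R) * A + Q * C)
semiconvergent-growth-≤ .(j + r) j r Q R A C T N refl 1≤A 1≤Q C≤A q′≤QT [T+1]²≤4N =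
  subst (λ S → d * W * T ≤ N * S) (sym regroup)
    (product-≤-by-amgm d W A Q T N 1≤A 1≤Q [T+1]²≤4N (begin
      d * A + Q * W                ≡⟨ regroup ⟨
      q′ * A + Q * C               ≤⟨ +-monoʳ-≤ (q′ * A) (*-monoʳ-≤ Q C≤A) ⟩
      q′ * A + Q * A               ≡⟨ *-distribʳ-+ A q′ Q ⟨
      (q′ + Q) * A                 ≤⟨ *-monoˡ-≤ A (+-monoˡ-≤ Q q′≤QT) ⟩
      (Q * T + Q) * A              ≡⟨ cong (_* A) (trans (+-comm (Q * T) Q) (sym (*-suc Q T))) ⟩
      Q * suc T * A                ∎))
  where
  open ≤-Reasoning
  d = j * Q + R
  W = r * A + C
  q′ = (j + r) * Q + R
  regroup : q′ * A + Q * C ≡ d * A + Q * W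
  regroup = identity j r Q R A C
    where
    identity : ∀ j r Q R A C → ((j + r) * Q + R) * A + Q * C ≡ (j * Q + R) * A + Q * (r * A + C)
    identity = ℕ-Ring.solve-∀

mpLe-semiconvergent : ∀ p a .{{_ : NonZero p}} → (∀ n → 1 ≤ a (suc n)) → ∀ k j r → a (suc k) ≡ j + r →
  ∀ v → PadicVal p (semiConvDen a k j) v → 1 ≤ semiConvDen a k j → ∀ T → 1 ≤ T →
  (∀ i → semiConvDen a k j * (r * leadCoeff a k i + lagCoeff a k i) * T ≤ p ^ v * qk a (suc k + i)) →
  mpLe p (infCF a) (frac (+ 1) T)
mpLe-semiconvergent p a pos k j r b≡j+r v val 1≤d T 1≤T growth =
  mpLe-intro {α = infCF a} d v (+ z) (suc k) 1≤d val bound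
  where
  d = semiConvDen a k j
  z = semiConvNum a k j
  bound : ∀ n → suc k ≤ n →
    frac (+ d) (p ^ v) ℚ.* ℚ.∣ frac (+ d) 1 ℚ.* frac (+ pk a n) (qk a n) ℚ.- frac (+ z) 1 ∣ ℚ.≤ frac (+ 1) T
  bound n k<n with m≤n⇒∃[o]m+o≡n k<n
  ... | i , refl = weighted-distance-≤ d (p ^ v) (pk a (suc k + i)) (qk a (suc k + i)) z T
    (m^n>0 p v) (1≤qk a (suc k + i) (λ n _ → pos n)) 1≤T
    (subst (λ w → d * w * T ≤ p ^ v * qk a (suc k + i)) (sym (semiconvergent-error a k j r i b≡j+r)) (growth i))

mpLe-convergent : ∀ p .{{_ : NonTrivial p}} .{{_ : NonZero p}} a → (∀ n → 1 ≤ a (suc n)) →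
  ∀ k T → 1 ≤ T → qk a k * T ≤ qk a (suc k) → mpLe p (infCF a) (frac (+ 1) T)
mpLe-convergent p a pos k T 1≤T QT≤q′ with padicVal-exists p (qk a k) (1≤qk a k (λ n _ → pos n))
... | v , val = mpLe-semiconvergent p a pos (suc k) 0 b refl v val (1≤qk a k (λ n _ → pos n)) T 1≤T growth
  where
  b = a (suc (suc k))
  growth : ∀ i → qk a k * (b * leadCoeff a (suc k) i + lagCoeff a (suc k) i) * T ≤ p ^ v * qk a (suc (suc k) + i)
  growth i = subst (λ x → qk a k * (b * A + C) * T ≤ p ^ v * x) (sym (qk-split a (suc k) i))
    (convergent-growth-≤ (qk a k) (qk a (suc k)) b A C T (p ^ v) (m^n>0 p v) QT≤q′)
    where
    A = leadCoeff a (suc k) i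
    C = lagCoeff a (suc k) i

mpLe-divisible-semiconvergent : ∀ p .{{_ : NonTrivial p}} .{{_ : NonZero p}} m a → (∀ n → 1 ≤ a (suc n)) →
  ∀ k j → j ≤ a (suc k) → semiConvDen a k j ≢ 0 → p ^ m ∣ semiConvDen a k j →
  ∀ T → 1 ≤ T → suc T * suc T ≤ 4 * p ^ m → qk a (suc k) ≤ qk a k * T →
  mpLe p (infCF a) (frac (+ 1) T)
mpLe-divisible-semiconvergent p m a pos k j j≤b d≢0 p^m∣d T 1≤T [T+1]²≤4p^m q′≤QT
  with padicVal-exists p (semiConvDen a k j) (n≢0⇒n>0 d≢0)
... | v , val = mpLe-semiconvergent p a pos k j r b≡j+r v val (n≢0⇒n>0 d≢0) T 1≤T growth
  where
  d = semiConvDen a k j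
  r = a (suc k) ∸ j
  b≡j+r = sym (m+[n∸m]≡n j≤b)
  growth : ∀ i → d * (r * leadCoeff a k i + lagCoeff a k i) * T ≤ p ^ v * qk a (suc k + i)
  growth i = subst (λ x → d * (r * A + C) * T ≤ p ^ v * x) (sym (qk-split a k i)) (begin
    d * (r * A + C) * T                           ≤⟨ semiconvergent-growth-≤ (a (suc k)) j r (qk a k) (qk-1 a k) A C T (p ^ m)
                                                       b≡j+r (1≤leadCoeff pos k i) (1≤qk a k (λ n _ → pos n))
                                                       (lagCoeff≤leadCoeff a k (pos (suc k)) i) q′≤QT [T+1]²≤4p^m ⟩
    p ^ m * (qk a (suc k) * A + qk a k * C)       ≤⟨ *-monoˡ-≤ _ (^-monoʳ-≤ p (padicVal-≥ {p} {d} {v} {m} val p^m∣d)) ⟩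
    p ^ v * (qk a (suc k) * A + qk a k * C)       ∎)
    where
    open ≤-Reasoning
    A = leadCoeff a k i
    C = lagCoeff a k i

mpLe-rational : ∀ p .{{_ : NonTrivial p}} .{{_ : NonZero p}} N a → (∀ n → n < N → 1 ≤ a (suc n)) →
  ∀ T → 1 ≤ T → mpLe p (finCF N a) (frac (+ 1) T)
mpLe-rational p N a pos T 1≤T with padicVal-exists p (qk a N) (1≤qk a N pos)
... | v , val = mpLe-intro {α = finCF N a} q v (+ P) N (1≤qk a N pos) val bound
  where
  q = qk a N
  P = pk a N
  exact : q * ∣ q * P - P * q ∣ * T ≤ p ^ v * q
  exact rewrite *-comm q P | ∣n-n∣≡0 (P * q) | *-zeroʳ q = z≤n
  bound : ∀ k → N ≤ k →
    frac (+ q) (p ^ v) ℚ.* ℚ.∣ frac (+ q) 1 ℚ.* approx (finCF N a) k ℚ.- frac (+ P) 1 ∣ ℚ.≤ frac (+ 1) T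
  bound k N≤k rewrite m≥n⇒m⊓n≡n N≤k = weighted-distance-≤ q (p ^ v) P q P T (m^n>0 p v) (1≤qk a N pos) 1≤T exact

4≤4*p^m : ∀ p m → Prime p → 4 ≤ 4 * p ^ m
4≤4*p^m p m pr = *-monoʳ-≤ 4 (m^n>0 p {{prime⇒nonZero pr}} m)

mainTheorem3 : (p m : ℕ) → Prime p → (α : CF) → ValidPos α
    → (∃[ d ] (SemiConvDen α d × d ≢ 0 × (p ^ m) ∣ d))
    → (s : ℕ) → s * s ≤ 4 * p ^ m → 4 * p ^ m < (s + 1) * (s + 1)
    → mpLe p α (frac (+ 1) (s ∸ 1))
mainTheorem3 p m pr α _ _ zero _ 4p^m<1 = ⊥-elim (<⇒≱ 4p^m<1 (≤-trans (s≤s z≤n) (4≤4*p^m p m pr)))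
mainTheorem3 p m pr α _ _ (suc zero) _ 4p^m<4 = ⊥-elim (<⇒≱ 4p^m<4 (4≤4*p^m p m pr))
mainTheorem3 p m pr (finCF N a) (pos , _) _ (suc (suc t)) _ _ =
  mpLe-rational p {{prime⇒nonTrivial pr}} {{prime⇒nonZero pr}} N a (λ n n<N → pos (suc n) (s≤s z≤n) n<N)
    (suc t) (s≤s z≤n)
mainTheorem3 p m pr (infCF a) pos (_ , (k , j , j≤b , refl) , d≢0 , p^m∣d) (suc (suc t)) s²≤4p^m _
  with qk a k * suc t ≤? qk a (suc k)
... | yes Qt≤q′ = mpLe-convergent p {{prime⇒nonTrivial pr}} {{prime⇒nonZero pr}} a pos k (suc t) (s≤s z≤n) Qt≤q′
... | no Qt≰q′ = mpLe-divisible-semiconvergent p {{prime⇒nonTrivial pr}} {{prime⇒nonZero pr}} m a pos k j j≤b d≢0 p^m∣d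
  (suc t) (s≤s z≤n) s²≤4p^m (<⇒≤ (≰⇒> Qt≰q′))
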